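{- Let $\approx$ be an SCER on $\Sigma^*$ and $T$ a string. For integers $i,j$ with $0\le i-1\le j\le|T|$, we have $\mathsf{Cov}_{\approx}(T[:j])\cap\mathsf{Cov}_{\approx}(T[i:])\subseteq\mathsf{Cov}_{\approx}(T)$.
   Context: $\Sigma^*$ is the set of strings over an alphabet $\Sigma$. For a string $T$, $|T|$ is its length, $T[i:j]$ the substring from position $i$ to $j$, $T[:j]=T[1:j]$, $T[i:]=T[i:|T|]$; $T[:0]$ and $T[|T|+1:]$ denote the empty string. An SCER is an equivalence relation $\approx$ on $\Sigma^*$ such that $X\approx Y$ implies $|X|=|Y|$ and $X[i:j]\approx Y[i:j]$ for all $1\le i\le j\le|X|$. $\mathsf{Occ}_{P,T}=\{\,i : 1\le i\le |T|-|P|+1,\ P\approx T[i:i+|P|-1]\,\}$. A string $C$ of length $c$ is a $\approx$-cover of $T$ of length $n$ if there are $x_1,\dots,x_m\in\mathsf{Occ}_{C,T}$ with $x_1=1$, $x_m=n-c+1$ and $x_{i-1}<x_i\le x_{i-1}+c$ for all $1<i\le m$; $\mathsf{Cov}_\approx(T)$ is the set of all $\approx$-covers of $T$. -}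

module Defs where

open import Data.Nat using (ℕ; zero; suc; _+_; _∸_; _≤_; _<_)
open import Data.List using (List; length; take; drop)
open import Data.Product using (Σ; _×_)
open import Relation.Binary.Core using (Rel)
open import Relation.Binary.Structures using (IsEquivalence)
open import Relation.Binary.PropositionalEquality using (_≡_)

-- 1-based substring T[i:j] = T[i..j]  (empty when j = i - 1)
sub : {A : Set} → List A → ℕ → ℕ → List A
sub T i j = take (suc j ∸ i) (drop (i ∸ 1) T)

pre : {A : Set} → List A → ℕ → List A
pre T j = take j T

suf : {A : Set} → List A → ℕ → List A
suf T i = drop (i ∸ 1) T

record IsSCER {Σ' : Set} (_≈_ : Rel (List Σ') _) : Set where
  field
    isEquivalence : IsEquivalence _≈_
    length-≡      : ∀ {X Y} → X ≈ Y → length X ≡ length Y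
    substring     : ∀ {X Y} → X ≈ Y → ∀ i j → 1 ≤ i → i ≤ j → j ≤ length X →
                    sub X i j ≈ sub Y i j

Occ : {Σ' : Set} → Rel (List Σ') _ → List Σ' → List Σ' → ℕ → Set
Occ _≈_ P T i =
  (1 ≤ i) × (i + length P ≤ length T + 1) × (P ≈ sub T i (i + length P ∸ 1))

IsCover : {Σ' : Set} → Rel (List Σ') _ → List Σ' → List Σ' → Set
IsCover _≈_ C T =
  Σ ℕ λ m → Σ (ℕ → ℕ) λ x →
    (1 ≤ m)
    × (∀ k → 1 ≤ k → k ≤ m → Occ _≈_ C T (x k))
    × (x 1 ≡ 1)
    × (x m + length C ≡ length T + 1)
    × (∀ k → 2 ≤ k → k ≤ m → (x (k ∸ 1) < x k) × (x k ≤ x (k ∸ 1) + length C))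

-- Cut the prefix cover at its last occurrence x k₀ lying inside T[:i-1].  That occurrence
-- reaches position i (the next one, or the end of T[:j], starts after i - 1), so it
-- overlaps the first occurrence of the suffix cover, which starts at i; the positions
-- x 1, …, x k₀ followed by the suffix positions shifted by i - 1 therefore cover T.
module Submission where

open import Defs
open import Data.Nat using (ℕ; zero; suc; _+_; _∸_; _⊓_; _≤_; _<_; z≤n; s≤s; _≤?_)
open import Data.Nat.Properties
open import Algebra.Properties.CommutativeSemigroup +-commutativeSemigroup using (xy∙z≈xz∙y)
open import Data.List using (List; length; take; drop)
open import Data.List.Properties using (length-take; length-drop; take-take; take-drop; drop-drop)
open import Data.Product using (∃; _×_; _,_; proj₂)
open import Data.Empty using (⊥-elim)
open import Level using (0ℓ)
open import Relation.Binary.Core using (Rel)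
open import Relation.Binary.PropositionalEquality
open import Relation.Binary.Definitions using (tri<; tri≈; tri>)
open import Relation.Nullary using (yes; no)

m+n≤o∸p⇒m+p+n≤o : ∀ m n {o p} → p ≤ o → m + n ≤ o ∸ p → m + p + n ≤ o
m+n≤o∸p⇒m+p+n≤o m n {o} {p} p≤o m+n≤o∸p = begin
  m + p + n ≡⟨ xy∙z≈xz∙y m p n ⟩
  m + n + p ≤⟨ +-monoˡ-≤ p m+n≤o∸p ⟩
  o ∸ p + p ≡⟨ m∸n+n≡m p≤o ⟩
  o         ∎
  where open ≤-Reasoning

m+n≡o∸p+1⇒m+p+n≡o+1 : ∀ m n {o p} → p ≤ o → m + n ≡ o ∸ p + 1 → m + p + n ≡ o + 1
m+n≡o∸p+1⇒m+p+n≡o+1 m n {o} {p} p≤o m+n≡o∸p+1 = begin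
  m + p + n     ≡⟨ xy∙z≈xz∙y m p n ⟩
  m + n + p     ≡⟨ cong (_+ p) m+n≡o∸p+1 ⟩
  o ∸ p + 1 + p ≡⟨ xy∙z≈xz∙y (o ∸ p) 1 p ⟩
  o ∸ p + p + 1 ≡⟨ cong (_+ 1) (m∸n+n≡m p≤o) ⟩
  o + 1         ∎
  where open ≡-Reasoning

length-take-≤ : ∀ {A : Set} {j} (T : List A) → j ≤ length T → length (take j T) ≡ j
length-take-≤ {j = j} T j≤T = trans (length-take j T) (m≤n⇒m⊓n≡m j≤T)

take-drop-take : ∀ {A : Set} {p c j} (T : List A) → p + c ≤ j →
                 take c (drop p (take j T)) ≡ take c (drop p T)
take-drop-take {p = p} {c} {j} T p+c≤j = begin
  take c (drop p (take j T))       ≡⟨ take-drop c p (take j T) ⟩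
  drop p (take (p + c) (take j T)) ≡⟨ cong (drop p) (take-take (p + c) j T) ⟩
  drop p (take ((p + c) ⊓ j) T)    ≡⟨ cong (λ n → drop p (take n T)) (m≤n⇒m⊓n≡m p+c≤j) ⟩
  drop p (take (p + c) T)          ≡⟨ take-drop c p T ⟨
  take c (drop p T)                ∎
  where open ≡-Reasoning

module _ {Σ' : Set} (_≈_ : Rel (List Σ') 0ℓ) {C : List Σ'} where

  private
    c = length C

  occ⇒window : ∀ {T p} → Occ _≈_ C T (suc p) → (p + c ≤ length T) × (C ≈ take c (drop p T))
  occ⇒window {T} {p} (_ , bound , C≈) =
    ≤-pred (subst (suc p + c ≤_) (+-comm (length T) 1) bound) ,
    subst (C ≈_) (cong (λ n → take n (drop p T)) (m+n∸m≡n p c)) C≈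

  window⇒occ : ∀ {T p} → p + c ≤ length T → C ≈ take c (drop p T) → Occ _≈_ C T (suc p)
  window⇒occ {T} {p} bound C≈ =
    s≤s z≤n ,
    subst (suc p + c ≤_) (+-comm 1 (length T)) (s≤s bound) ,
    subst (C ≈_) (cong (λ n → take n (drop p T)) (sym (m+n∸m≡n p c))) C≈

  occ-take : ∀ {T j q} → j ≤ length T → Occ _≈_ C (take j T) q → Occ _≈_ C T q
  occ-take {T} {j} {suc p} j≤T occ with occ⇒window occ
  ... | bound , C≈ = window⇒occ (≤-trans bound′ j≤T) (subst (C ≈_) (take-drop-take T bound′) C≈)
    where
    bound′ : p + c ≤ j
    bound′ = subst (p + c ≤_) (length-take-≤ T j≤T) bound

  occ-drop : ∀ {T d q} → d ≤ length T → Occ _≈_ C (drop d T) q → Occ _≈_ C T (q + d)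
  occ-drop {T} {d} {suc p} d≤T occ with occ⇒window occ
  ... | bound , C≈ = window⇒occ
    (m+n≤o∸p⇒m+p+n≤o p c d≤T (subst (p + c ≤_) (length-drop d T) bound))
    (subst (C ≈_) (cong (take c) (trans (drop-drop d p T) (cong (λ n → drop n T) (+-comm d p)))) C≈)

Step : ℕ → ℕ → ℕ → Set
Step c a b = a < b × b ≤ a + c

IsChain : ℕ → ℕ → (ℕ → ℕ) → Set
IsChain c m x = ∀ k → 2 ≤ k → k ≤ m → Step c (x (k ∸ 1)) (x k)

AllUpTo : ℕ → (ℕ → Set) → (ℕ → ℕ) → Set
AllUpTo m P x = ∀ k → 1 ≤ k → k ≤ m → P (x k)

chain-restrict : ∀ {c m k x} → k ≤ m → IsChain c m x → IsChain c k x
chain-restrict k≤m chain i 2≤i i≤k = chain i 2≤i (≤-trans i≤k k≤m)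

allUpTo-restrict : ∀ {P x m k} → k ≤ m → AllUpTo m P x → AllUpTo k P x
allUpTo-restrict k≤m all i 1≤i i≤k = all i 1≤i (≤-trans i≤k k≤m)

chain-shift : ∀ {c m y} d → IsChain c m y → IsChain c m (λ k → y k + d)
chain-shift {c} {y = y} d chain k 2≤k k≤m with chain k 2≤k k≤m
... | y< , y≤ = +-monoˡ-< d y< , ≤-trans (+-monoˡ-≤ d y≤) (≤-reflexive (xy∙z≈xz∙y (y (k ∸ 1)) c d))

chain-crossing : ∀ {c d x} m → IsChain c (suc m) x → x 1 ≤ d → d < x (suc m) + c →
                 ∃ λ k → 1 ≤ k × k ≤ suc m × x k ≤ d × d < x k + c
chain-crossing zero _ x₁≤d d<end = 1 , ≤-refl , ≤-refl , x₁≤d , d<end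
chain-crossing {c} {d} {x} (suc m) chain x₁≤d d<end with x (suc (suc m)) ≤? d
... | yes xₘ≤d = suc (suc m) , s≤s z≤n , ≤-refl , xₘ≤d , d<end
... | no xₘ≰d
  with chain-crossing m (chain-restrict (n≤1+n (suc m)) chain) x₁≤d
         (<-≤-trans (≰⇒> xₘ≰d) (proj₂ (chain (suc (suc m)) (s≤s (s≤s z≤n)) ≤-refl)))
...   | k , 1≤k , k≤m , rest = k , 1≤k , m≤n⇒m≤1+n k≤m , rest

splice : ℕ → (ℕ → ℕ) → (ℕ → ℕ) → ℕ → ℕ
splice k₀ x y k with k ≤? k₀
... | yes _ = x k
... | no _  = y (k ∸ k₀)

splice-≤ : ∀ {k₀ x y k} → k ≤ k₀ → splice k₀ x y k ≡ x k
splice-≤ {k₀} {k = k} k≤k₀ with k ≤? k₀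
... | yes _   = refl
... | no k≰k₀ = ⊥-elim (k≰k₀ k≤k₀)

splice-> : ∀ {k₀ x y k} → k₀ < k → splice k₀ x y k ≡ y (k ∸ k₀)
splice-> {k₀} {k = k} k₀<k with k ≤? k₀
... | yes k≤k₀ = ⊥-elim (<⇒≱ k₀<k k≤k₀)
... | no _     = refl

allUpTo-splice : ∀ {P x y k₀ m} → AllUpTo k₀ P x → AllUpTo m P y →
                 AllUpTo (k₀ + m) P (splice k₀ x y)
allUpTo-splice {k₀ = k₀} allx ally k 1≤k k≤k₀+m with k ≤? k₀
... | yes k≤k₀ = allx k 1≤k k≤k₀
... | no k≰k₀  = ally (k ∸ k₀) (m<n⇒0<n∸m (≰⇒> k≰k₀)) (m≤n+o⇒m∸n≤o k k₀ k≤k₀+m)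

chain-splice : ∀ {c k₀ m x y} → IsChain c k₀ x → IsChain c m y → Step c (x k₀) (y 1) →
               IsChain c (k₀ + m) (splice k₀ x y)
chain-splice {c} {k₀} {m} {x} {y} chainx chainy step (suc k) (s≤s 1≤k) k<k₀+m with <-cmp k k₀
... | tri< k<k₀ _ _ =
  subst₂ (Step c) (sym (splice-≤ (<⇒≤ k<k₀))) (sym (splice-≤ k<k₀)) (chainx (suc k) (s≤s 1≤k) k<k₀)
... | tri≈ _ refl _ =
  subst₂ (Step c) (sym (splice-≤ {x = x} {y} ≤-refl))
    (sym (trans (splice-> (n<1+n k₀)) (cong y (m+n∸n≡m 1 k₀)))) step
... | tri> _ _ k₀<k =
  subst₂ (Step c) (sym (splice-> k₀<k))
    (sym (trans (splice-> (m<n⇒m<1+n k₀<k)) (cong y (+-∸-assoc 1 (<⇒≤ k₀<k)))))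
    (chainy (suc (k ∸ k₀)) (s≤s (m<n⇒0<n∸m k₀<k))
      (subst (_≤ m) (+-∸-assoc 1 (<⇒≤ k₀<k)) (m≤n+o⇒m∸n≤o (suc k) k₀ k<k₀+m)))

module _ {Σ' : Set} (_≈_ : Rel (List Σ') 0ℓ) {C T : List Σ'} where

  private
    c = length C

  cover-glue : ∀ {d j} → 1 ≤ d → d ≤ j → j ≤ length T →
               IsCover _≈_ C (take j T) → IsCover _≈_ C (drop d T) → IsCover _≈_ C T
  cover-glue {d} {j} 1≤d d≤j j≤T (suc m₁ , x , _ , occx , x₁≡1 , xₘ+c≡ , chainx)
                                 (m₂ , y , 1≤m₂ , occy , y₁≡1 , yₘ+c≡ , chainy)
    with chain-crossing m₁ chainx (subst (_≤ d) (sym x₁≡1) 1≤d)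
           (subst (d <_) (sym (trans xₘ+c≡ (cong (_+ 1) (length-take-≤ T j≤T))))
                  (≤-<-trans d≤j (m<m+n j (s≤s z≤n))))
  ... | k₀ , 1≤k₀ , k₀≤m₁ , xₖ₀≤d , d<xₖ₀+c =
    k₀ + m₂ , z , ≤-trans 1≤m₂ (m≤n+m m₂ k₀) , occz , z₁≡1 , zₘ+c≡ ,
    chain-splice (chain-restrict k₀≤m₁ chainx) (chain-shift d chainy) junction
    where
    d≤T : d ≤ length T
    d≤T = ≤-trans d≤j j≤T

    y′ : ℕ → ℕ
    y′ k = y k + d

    z : ℕ → ℕ
    z = splice k₀ x y′

    occx′ : AllUpTo (suc m₁) (Occ _≈_ C T) x
    occx′ k 1≤k k≤m = occ-take _≈_ j≤T (occx k 1≤k k≤m)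

    occy′ : AllUpTo m₂ (Occ _≈_ C T) y′
    occy′ k 1≤k k≤m = occ-drop _≈_ d≤T (occy k 1≤k k≤m)

    occz : AllUpTo (k₀ + m₂) (Occ _≈_ C T) z
    occz = allUpTo-splice {Occ _≈_ C T} {x} (allUpTo-restrict {Occ _≈_ C T} {x} k₀≤m₁ occx′) occy′

    z₁≡1 : z 1 ≡ 1
    z₁≡1 = trans (splice-≤ 1≤k₀) x₁≡1

    zₘ+c≡ : z (k₀ + m₂) + c ≡ length T + 1
    zₘ+c≡ = trans (cong (_+ c) (trans (splice-> {x = x} {y′} (m<m+n k₀ 1≤m₂))
                                      (cong y′ (m+n∸m≡n k₀ m₂))))
                  (m+n≡o∸p+1⇒m+p+n≡o+1 (y m₂) c d≤T (trans yₘ+c≡ (cong (_+ 1) (length-drop d T))))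

    junction : Step c (x k₀) (y′ 1)
    junction rewrite y₁≡1 = s≤s xₖ₀≤d , d<xₖ₀+c

lemma7 : {Σ' : Set} (_≈_ : Rel (List Σ') _) → IsSCER _≈_ →
         (T : List Σ') (i j : ℕ) → 1 ≤ i → i ∸ 1 ≤ j → j ≤ length T →
         (C : List Σ') → IsCover _≈_ C (pre T j) → IsCover _≈_ C (suf T i) →
         IsCover _≈_ C T
lemma7 _≈_ _ T (suc zero)    j _ _     _   C _         coverSuf = coverSuf
lemma7 _≈_ _ T (suc (suc d)) j _ d<j j≤T C coverPre coverSuf =
  cover-glue _≈_ (s≤s z≤n) d<j j≤T coverPre coverSuf
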